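{- Let $G=(V,E)$ be a $4$-regular $4$-edge connected multigraph, let $v\in V$, and let $e=vx$ be an edge incident to $v$. Then (i) $|A_e|\ge 2$; and (ii) if $(e,f)$ is an admissible pair for some $f=vy\in\delta(v)\setminus\{e\}$, then the remaining two edges in $\delta(v)\setminus\{e,f\}$ form an admissible pair in $G_{x,y}$.
   Context: Parallel edges are counted separately towards degrees and cut sizes; $\lambda_H(a,b)$ denotes the minimum size of an $(a,b)$-cut in a multigraph $H$. For two edges $sv,vt$ sharing endpoint $v$, the graph $G_{s,t}$ obtained by splitting off the pair $(sv,vt)$ at $v$ is $G+st-sv-vt$. Fix the vertex $v$ and $k=4$: for a multigraph $H$ with $\lambda_H(a,b)\ge 4$ for all $a,b\in V\setminus\{v\}$, a pair $(sv,vt)$ of edges at $v$ is admissible in $H$ if $\lambda_{H_{s,t}}(a,b)\ge 4$ for all $a,b\in V\setminus\{v\}$. For an edge $e\in\delta(v)$, $A_e$ is the set of edges $f\in\delta(v)\setminus\{e\}$ such that $(e,f)$ is an admissible pair in $G$. -}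

module Defs where

open import Data.Nat using (ℕ; zero; suc; _+_; _≤_)
open import Data.Fin using (Fin; zero; suc; _≟_)
open import Data.Bool using (Bool; true; false; if_then_else_; _xor_)
open import Data.Maybe using (Maybe; just; nothing)
open import Data.Product using (_×_; _,_; Σ; ∃; ∃-syntax)
open import Data.Sum using (_⊎_)
open import Relation.Nullary using (¬_; does)
open import Relation.Binary.PropositionalEquality using (_≡_; _≢_)

Edge : ℕ → Set
Edge n = Fin n × Fin n

-- A multigraph on vertex set Fin n with m edge *slots*; slot i holds
-- either an edge (just (a , b)) or nothing (no edge). Parallel edges are
-- distinct slots, so they are counted separately.
MGraph : ℕ → ℕ → Set
MGraph n m = Fin m → Maybe (Edge n)

sumFin : ∀ {m} → (Fin m → ℕ) → ℕ
sumFin {zero}  f = 0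
sumFin {suc m} f = f zero + sumFin (λ i → f (suc i))

crosses : ∀ {n} → (Fin n → Bool) → Maybe (Edge n) → ℕ
crosses S nothing = 0
crosses S (just (a , b)) = if S a xor S b then 1 else 0

cutSize : ∀ {n m} → MGraph n m → (Fin n → Bool) → ℕ
cutSize H S = sumFin (λ i → crosses S (H i))

ends : ∀ {n} → Fin n → Maybe (Edge n) → ℕ
ends u nothing = 0
ends u (just (a , b)) = (if does (a ≟ u) then 1 else 0) + (if does (b ≟ u) then 1 else 0)

degree : ∀ {n m} → MGraph n m → Fin n → ℕ
degree H u = sumFin (λ i → ends u (H i))

Loopless : ∀ {n m} → MGraph n m → Set
Loopless H = ∀ i a b → H i ≡ just (a , b) → a ≢ b

Regular : ∀ {n m} → ℕ → MGraph n m → Set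
Regular k H = ∀ u → degree H u ≡ k

EdgeConnected : ∀ {n m} → ℕ → MGraph n m → Set
EdgeConnected k H = ∀ (S : Fin _ → Bool) → (∃[ a ] S a ≡ true) → (∃[ b ] S b ≡ false) → k ≤ cutSize H S

LambdaAtLeast : ∀ {n m} → ℕ → MGraph n m → Fin n → Fin n → Set
LambdaAtLeast k H a b = ∀ (S : Fin _ → Bool) → S a ≡ true → S b ≡ false → k ≤ cutSize H S

ConnAway : ∀ {n m} → ℕ → Fin n → MGraph n m → Set
ConnAway k v H = ∀ a b → a ≢ v → b ≢ v → LambdaAtLeast k H a b

EdgeTo : ∀ {n m} → MGraph n m → Fin n → Fin m → Fin n → Set
EdgeTo H v e s = H e ≡ just (v , s) ⊎ H e ≡ just (s , v)

Incident : ∀ {n m} → MGraph n m → Fin n → Fin m → Set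
Incident H v e = ∃[ s ] EdgeTo H v e s

-- H_{s,t}: splitting off the pair (e = sv, f = vt): H + st − e − f.
-- The new edge st is stored in slot e, slot f becomes empty.
splitOff : ∀ {n m} → MGraph n m → Fin m → Fin m → Fin n → Fin n → MGraph n m
splitOff H e f s t i =
  if does (i ≟ e) then just (s , t) else (if does (i ≟ f) then nothing else H i)

Admissible : ∀ {n m} → Fin n → MGraph n m → Fin m → Fin m → Set
Admissible v H e f =
  e ≢ f × Σ _ λ s → Σ _ λ t → EdgeTo H v e s × EdgeTo H v f t × ConnAway 4 v (splitOff H e f s t)

InA : ∀ {n m} → Fin n → MGraph n m → Fin m → Fin m → Set
InA v G e f = Incident G v f × f ≢ e × Admissible v G e f

-- As G is loopless and 4-regular, v has exactly four incident edges e = vx, f₁, f₂, f₃. If splitting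
-- off (e, fⱼ) with fⱼ = vyⱼ fails, a cut of G_{x,yⱼ} of size below 4 becomes, after complementing so
-- that v lies outside, a tight set of G: its cut has size 4, it contains x and yⱼ but not v. Indeed
-- putting the two edges back raises that cut by exactly 2, and every cut of a 4-regular graph is
-- even. Tight sets for two different j cannot coexist (by submodularity, or posimodularity, of the
-- cut function), so at most one of the three pairs fails, which is (i). For (ii), after splitting
-- off both pairs v is isolated; moving v to the side of s′, where g = vs′, turns any cut of the
-- final graph into a cut of G_{x,y} of the same size.
module Submission where

open import Defs
open import Data.Nat using (ℕ; zero; suc; _+_; _*_; _≤_; _<_; z≤n; s≤s; _≤?_)
open import Data.Nat.Properties hiding (_≟_)
open import Data.Nat.Divisibility
  using (_∣_; _∣?_; divides; _∣0; ∣m∣n⇒∣m+n; ∣m+n∣m⇒∣n; ∣n⇒∣m*n; m∣m*n)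
import Data.Nat as ℕ
open import Data.Fin using (Fin; zero; suc; _≟_)
open import Data.Fin.Properties using (any?)
open import Data.Fin.Subset.Properties using (anySubset?)
open import Data.Vec using (lookup; tabulate)
open import Data.Vec.Properties using (lookup∘tabulate)
open import Function.Definitions using (Injective)
open import Data.Fin.Patterns using (0F; 1F; 2F)
open import Data.Bool using (Bool; true; false; if_then_else_; _xor_; not; _∧_; _∨_)
open import Data.Bool.Properties using (xor-comm; xor-same; ∨-zeroʳ) renaming (_≟_ to _≟ᴮ_)
open import Data.Maybe using (Maybe; just; nothing)
open import Data.Maybe.Properties using (just-injective)
open import Data.Vec.Functional using (updateAt)
open import Data.Vec.Functional.Properties using (updateAt-updates; updateAt-minimal)
open import Data.Product using (_×_; _,_; Σ; ∃; proj₁; proj₂)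
open import Data.Sum using (_⊎_; inj₁; inj₂)
import Data.Sum as Sum
open import Data.Empty using (⊥; ⊥-elim)
open import Function using (_∘_; const)
open import Relation.Nullary using (¬_; Dec; yes; no; does; contradiction)
open import Relation.Nullary.Decidable using (toWitness; from-no; dec-true; dec-false; ¬?; _×-dec_)
open import Relation.Binary.PropositionalEquality
open import Algebra.Properties.CommutativeMonoid.Sum +-0-commutativeMonoid
  using (sum; ∑-distrib-+; ∑-comm; sum-replicate-zero)
open import Algebra.Properties.Semiring.Sum +-*-semiring using (*-distribˡ-sum)
open import Algebra.Properties.CommutativeSemigroup +-commutativeSemigroup using (x∙yz≈y∙xz; interchange)
open import Data.List using (List; []; _∷_; length)
open import Data.List.Relation.Unary.All as All using (All; []; _∷_)
open import Data.List.Relation.Unary.AllPairs using ([]; _∷_)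
open import Data.List.Relation.Unary.Unique.Propositional using (Unique)

bit : Bool → ℕ
bit b = if b then 1 else 0

differ : Bool → Bool → ℕ
differ p q = bit (p xor q)

all-Bool? : {P : Bool → Set} → (∀ b → Dec (P b)) → Dec (∀ b → P b)
all-Bool? P? with P? false | P? true
... | yes f | yes t = yes λ { false → f ; true → t }
... | no ¬f | _     = no λ all → ¬f (all false)
... | _     | no ¬t = no λ all → ¬t (all true)

differ-xor : ∀ c p q → differ (c xor p) (c xor q) ≡ differ p q
differ-xor = toWitness {a? = all-Bool? λ c → all-Bool? λ p → all-Bool? λ q → _ ℕ.≟ _} _

differ-submodular : ∀ p₁ p₂ q₁ q₂ →
  differ (p₁ ∧ q₁) (p₂ ∧ q₂) + differ (p₁ ∨ q₁) (p₂ ∨ q₂) ≤ differ p₁ p₂ + differ q₁ q₂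
differ-submodular = toWitness {a? = all-Bool? λ _ → all-Bool? λ _ → all-Bool? λ _ → all-Bool? λ _ → _ ≤? _} _

differ-posimodular : ∀ p₁ p₂ q₁ q₂ →
  differ (p₁ ∧ not q₁) (p₂ ∧ not q₂) + differ (q₁ ∧ not p₁) (q₂ ∧ not p₂)
    ≤ differ p₁ p₂ + differ q₁ q₂
differ-posimodular = toWitness {a? = all-Bool? λ _ → all-Bool? λ _ → all-Bool? λ _ → all-Bool? λ _ → _ ≤? _} _

differ-insert : ∀ p q r s → differ (r ∨ p) (s ∨ q) ≤ differ p q + (bit r + bit s)
differ-insert = toWitness {a? = all-Bool? λ _ → all-Bool? λ _ → all-Bool? λ _ → all-Bool? λ _ → _ ≤? _} _

bit-+ : ∀ p q → bit p + bit q ≡ differ p q + 2 * bit (p ∧ q)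
bit-+ = toWitness {a? = all-Bool? λ _ → all-Bool? λ _ → _ ℕ.≟ _} _

bit-*-+ : ∀ p q r → bit p * (bit q + bit r) ≡ (if q then bit p else 0) + (if r then bit p else 0)
bit-*-+ = toWitness {a? = all-Bool? λ _ → all-Bool? λ _ → all-Bool? λ _ → _ ℕ.≟ _} _

sumFin≡sum : ∀ {m} (f : Fin m → ℕ) → sumFin f ≡ sum f
sumFin≡sum {zero}  f = refl
sumFin≡sum {suc m} f = cong (f zero +_) (sumFin≡sum (f ∘ suc))

sumFin-cong : ∀ {m} {f g : Fin m → ℕ} → (∀ i → f i ≡ g i) → sumFin f ≡ sumFin g
sumFin-cong {zero}  f≗g = refl
sumFin-cong {suc m} f≗g = cong₂ _+_ (f≗g zero) (sumFin-cong (f≗g ∘ suc))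

sumFin-mono : ∀ {m} {f g : Fin m → ℕ} → (∀ i → f i ≤ g i) → sumFin f ≤ sumFin g
sumFin-mono {zero}  f≤g = z≤n
sumFin-mono {suc m} f≤g = +-mono-≤ (f≤g zero) (sumFin-mono (f≤g ∘ suc))

sumFin-zero : ∀ m → sumFin {m} (const 0) ≡ 0
sumFin-zero m = trans (sumFin≡sum {m} (const 0)) (sum-replicate-zero m)

sumFin-+ : ∀ {m} (f g : Fin m → ℕ) → sumFin (λ i → f i + g i) ≡ sumFin f + sumFin g
sumFin-+ f g = begin
  sumFin (λ i → f i + g i)  ≡⟨ sumFin≡sum (λ i → f i + g i) ⟩
  sum (λ i → f i + g i)     ≡⟨ ∑-distrib-+ f g ⟩
  sum f + sum g             ≡⟨ sym (cong₂ _+_ (sumFin≡sum f) (sumFin≡sum g)) ⟩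
  sumFin f + sumFin g       ∎
  where open ≡-Reasoning

sumFin-*ˡ : ∀ {m} c (f : Fin m → ℕ) → c * sumFin f ≡ sumFin (λ i → c * f i)
sumFin-*ˡ c f = begin
  c * sumFin f             ≡⟨ cong (c *_) (sumFin≡sum f) ⟩
  c * sum f                ≡⟨ *-distribˡ-sum c f ⟩
  sum (λ i → c * f i)      ≡⟨ sym (sumFin≡sum (λ i → c * f i)) ⟩
  sumFin (λ i → c * f i)   ∎
  where open ≡-Reasoning

sumFin-comm : ∀ {m n} (f : Fin m → Fin n → ℕ) →
  sumFin (λ i → sumFin (f i)) ≡ sumFin (λ j → sumFin (λ i → f i j))
sumFin-comm f = begin
  sumFin (λ i → sumFin (f i))            ≡⟨ sumFin²≡sum² f ⟩
  sum (λ i → sum (f i))                  ≡⟨ ∑-comm f ⟩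
  sum (λ j → sum (λ i → f i j))          ≡⟨ sumFin²≡sum² (λ j i → f i j) ⟨
  sumFin (λ j → sumFin (λ i → f i j))    ∎
  where
  open ≡-Reasoning
  sumFin²≡sum² : ∀ {m n} (g : Fin m → Fin n → ℕ) → sumFin (λ i → sumFin (g i)) ≡ sum (λ i → sum (g i))
  sumFin²≡sum² g = trans (sumFin-cong (sumFin≡sum ∘ g)) (sumFin≡sum (λ i → sum (g i)))

∣-sumFin : ∀ {m d} (f : Fin m → ℕ) → (∀ i → d ∣ f i) → d ∣ sumFin f
∣-sumFin {zero}  f d∣f = _ ∣0
∣-sumFin {suc m} f d∣f = ∣m∣n⇒∣m+n (d∣f zero) (∣-sumFin (f ∘ suc) (d∣f ∘ suc))

sumFin-select : ∀ {m} (f : Fin m → ℕ) a → sumFin (λ i → if does (i ≟ a) then f i else 0) ≡ f a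
sumFin-select {suc m} f zero    = begin
  f zero + sumFin {m} (const 0)  ≡⟨ cong (f zero +_) (sumFin-zero m) ⟩
  f zero + 0                     ≡⟨ +-identityʳ (f zero) ⟩
  f zero                         ∎
  where open ≡-Reasoning
sumFin-select {suc m} f (suc a) = sumFin-select (f ∘ suc) a

sumFin-remove : ∀ {m} (f : Fin m → ℕ) a → sumFin f ≡ f a + sumFin (updateAt f a (const 0))
sumFin-remove f zero    = refl
sumFin-remove f (suc a) = begin
  f zero + sumFin (f ∘ suc)                                       ≡⟨ cong (f zero +_) (sumFin-remove (f ∘ suc) a) ⟩
  f zero + (f (suc a) + sumFin (updateAt (f ∘ suc) a (const 0)))  ≡⟨ x∙yz≈y∙xz (f zero) (f (suc a)) _ ⟩
  f (suc a) + (f zero + sumFin (updateAt (f ∘ suc) a (const 0)))  ∎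
  where open ≡-Reasoning

sumFin-remove-unit : ∀ {m} (f : Fin m → ℕ) a → f a ≡ 1 → sumFin f ≡ suc (sumFin (updateAt f a (const 0)))
sumFin-remove-unit f a fa≡1 = trans (sumFin-remove f a) (cong (_+ sumFin (updateAt f a (const 0))) fa≡1)

updateAt-0-mono : ∀ {m} {f g : Fin m → ℕ} a → (∀ i → f i ≤ g i) →
  ∀ i → updateAt f a (const 0) i ≤ updateAt g a (const 0) i
updateAt-0-mono {f = f} {g} a f≤g i with i ≟ a
... | yes refl rewrite updateAt-updates i {const 0} f | updateAt-updates i {const 0} g = z≤n
... | no i≢a   = subst₂ _≤_ (sym (updateAt-minimal i a {const 0} f i≢a))
                             (sym (updateAt-minimal i a {const 0} g i≢a)) (f≤g i)

updateAt-0-≤ : ∀ {m} (f : Fin m → ℕ) a i → updateAt f a (const 0) i ≤ f i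
updateAt-0-≤ f a i with i ≟ a
... | yes refl = subst (_≤ f i) (sym (updateAt-updates i {const 0} f)) z≤n
... | no i≢a   = ≤-reflexive (updateAt-minimal i a {const 0} f i≢a)

updateAt-0-pos : ∀ {m} (f : Fin m → ℕ) a i → 0 < updateAt f a (const 0) i →
  i ≢ a × updateAt f a (const 0) i ≡ f i
updateAt-0-pos f a i pos with i ≟ a
... | yes refl = contradiction (subst (0 <_) (updateAt-updates i {const 0} f) pos) λ ()
... | no i≢a   = i≢a , updateAt-minimal i a {const 0} f i≢a

sumFin-mono-gaps : ∀ {m} {f g : Fin m → ℕ} {k} {is : List (Fin m)} → (∀ i → f i ≤ g i) → Unique is →
  All (λ i → f i + k ≤ g i) is → sumFin f + length is * k ≤ sumFin g
sumFin-mono-gaps f≤g [] [] = ≤-trans (≤-reflexive (+-identityʳ _)) (sumFin-mono f≤g)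
sumFin-mono-gaps {f = f} {g} {k} {i ∷ is} f≤g (i∉is ∷ unique) (gap ∷ gaps) = begin
  sumFin f + (k + length is * k)           ≡⟨ cong (_+ (k + length is * k)) (sumFin-remove f i) ⟩
  (f i + sumFin f′) + (k + length is * k)  ≡⟨ interchange (f i) (sumFin f′) k (length is * k) ⟩
  (f i + k) + (sumFin f′ + length is * k)  ≤⟨ +-mono-≤ gap (sumFin-mono-gaps (updateAt-0-mono i f≤g) unique gaps′) ⟩
  g i + sumFin g′                          ≡⟨ sym (sumFin-remove g i) ⟩
  sumFin g                                 ∎
  where
  open ≤-Reasoning
  f′ g′ : Fin _ → ℕ
  f′ = updateAt f i (const 0)
  g′ = updateAt g i (const 0)
  gaps′ : All (λ j → f′ j + k ≤ g′ j) is
  gaps′ = All.zipWith (λ { {j} (i≢j , gap) → subst₂ (λ a b → a + k ≤ b)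
                                                 (sym (updateAt-minimal j i {const 0} f (i≢j ∘ sym)))
                                                 (sym (updateAt-minimal j i {const 0} g (i≢j ∘ sym))) gap })
                      (i∉is , gaps)

sumFin-pos : ∀ {m} (f : Fin m → ℕ) → 0 < sumFin f → ∃ λ i → 0 < f i
sumFin-pos {m} f 0<Σ with any? (λ i → 1 ≤? f i)
... | yes pos = pos
... | no ∄pos = contradiction (≤-trans (sumFin-mono (λ i → ≮⇒≥ (∄pos ∘ (i ,_)))) (≤-reflexive (sumFin-zero m)))
                             (<⇒≱ 0<Σ)

sumFin-support : ∀ {m} k (f : Fin m → ℕ) → (∀ i → f i ≤ 1) → sumFin f ≡ k →
  Σ (Fin k → Fin m) λ ι → Injective _≡_ _≡_ ι × (∀ j → f (ι j) ≡ 1)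
sumFin-support zero    f f≤1 Σ≡k = (λ ()) , (λ { {()} }) , λ ()
sumFin-support (suc k) f f≤1 Σ≡k with sumFin-pos f (subst (0 <_) (sym Σ≡k) (s≤s z≤n))
... | i , 0<fi with sumFin-support k (updateAt f i (const 0)) (λ j → ≤-trans (updateAt-0-≤ f i j) (f≤1 j))
                      (suc-injective (trans (sym (sumFin-remove-unit f i (≤-antisym (f≤1 i) 0<fi))) Σ≡k))
... | ι′ , ι′-injective , ι′-support = ι , ι-injective , ι-support
  where
  ι′-avoids : ∀ j → ι′ j ≢ i × updateAt f i (const 0) (ι′ j) ≡ f (ι′ j)
  ι′-avoids j = updateAt-0-pos f i (ι′ j) (≤-reflexive (sym (ι′-support j)))
  ι : Fin (suc k) → Fin _
  ι zero    = i
  ι (suc j) = ι′ j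
  ι-injective : Injective _≡_ _≡_ ι
  ι-injective {zero}  {zero}   _  = refl
  ι-injective {zero}  {suc j}  eq = contradiction (sym eq) (proj₁ (ι′-avoids j))
  ι-injective {suc j} {zero}   eq = contradiction eq (proj₁ (ι′-avoids j))
  ι-injective {suc j} {suc j′} eq = cong suc (ι′-injective eq)
  ι-support : ∀ j → f (ι j) ≡ 1
  ι-support zero    = ≤-antisym (f≤1 i) 0<fi
  ι-support (suc j) = trans (sym (proj₂ (ι′-avoids j))) (ι′-support j)

module _ {n : ℕ} where

  infixr 7 _∩_
  infixr 6 _∪_ _∖_

  _∩_ _∪_ _∖_ : (Fin n → Bool) → (Fin n → Bool) → Fin n → Bool
  (S ∩ T) u = S u ∧ T u
  (S ∪ T) u = S u ∨ T u
  (S ∖ T) u = S u ∧ not (T u)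

  insert : Fin n → (Fin n → Bool) → Fin n → Bool
  insert v S u = does (u ≟ v) ∨ S u

crosses-EdgeTo : ∀ {n m} (H : MGraph n m) {v i y} → EdgeTo H v i y → ∀ S → crosses S (H i) ≡ differ (S v) (S y)
crosses-EdgeTo H (inj₁ Hi≡vy) S rewrite Hi≡vy = refl
crosses-EdgeTo H (inj₂ Hi≡yv) S rewrite Hi≡yv = cong bit (xor-comm (S _) (S _))

ends-EdgeTo : ∀ {n m} (H : MGraph n m) {v i y} → y ≢ v → EdgeTo H v i y → ends v (H i) ≡ 1
ends-EdgeTo H {v} {y = y} y≢v (inj₁ Hi≡vy) rewrite Hi≡vy | dec-true (v ≟ v) refl | dec-false (y ≟ v) y≢v = refl
ends-EdgeTo H {v} {y = y} y≢v (inj₂ Hi≡yv) rewrite Hi≡yv | dec-true (v ≟ v) refl | dec-false (y ≟ v) y≢v = refl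

cut-+ : ∀ {n m} (H : MGraph n m) S T → cutSize H S + cutSize H T ≡ sumFin (λ i → crosses S (H i) + crosses T (H i))
cut-+ H S T = sym (sumFin-+ (λ i → crosses S (H i)) (λ i → crosses T (H i)))

cut-cong : ∀ {n m} (H : MGraph n m) {S T : Fin n → Bool} → (∀ u → S u ≡ T u) → cutSize H S ≡ cutSize H T
cut-cong H S≗T = sumFin-cong λ i → crosses-cong (H i)
  where
  crosses-cong : ∀ w → crosses _ w ≡ crosses _ w
  crosses-cong nothing        = refl
  crosses-cong (just (a , b)) = cong₂ differ (S≗T a) (S≗T b)

cut-xor : ∀ {n m} (H : MGraph n m) c S → cutSize H (λ u → c xor S u) ≡ cutSize H S
cut-xor H c S = sumFin-cong λ i → crosses-xor (H i)
  where
  crosses-xor : ∀ w → crosses (λ u → c xor S u) w ≡ crosses S w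
  crosses-xor nothing        = refl
  crosses-xor (just (a , b)) = differ-xor c (S a) (S b)

cut-submodular : ∀ {n m} (H : MGraph n m) S T → cutSize H (S ∩ T) + cutSize H (S ∪ T) ≤ cutSize H S + cutSize H T
cut-submodular H S T = begin
  cutSize H (S ∩ T) + cutSize H (S ∪ T)                       ≡⟨ cut-+ H (S ∩ T) (S ∪ T) ⟩
  sumFin (λ i → crosses (S ∩ T) (H i) + crosses (S ∪ T) (H i)) ≤⟨ sumFin-mono (crosses-submodular ∘ H) ⟩
  sumFin (λ i → crosses S (H i) + crosses T (H i))             ≡⟨ cut-+ H S T ⟨
  cutSize H S + cutSize H T                                   ∎
  where
  open ≤-Reasoning
  crosses-submodular : ∀ w → crosses (S ∩ T) w + crosses (S ∪ T) w ≤ crosses S w + crosses T w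
  crosses-submodular nothing        = z≤n
  crosses-submodular (just (a , b)) = differ-submodular (S a) (S b) (T a) (T b)

-- The edge i, from outside S ∪ T into S ∩ T, crosses both S and T but neither difference.
cut-posimodular : ∀ {n m} (H : MGraph n m) S T {a i b} → EdgeTo H a i b →
  S a ≡ false → T a ≡ false → S b ≡ true → T b ≡ true →
  cutSize H (S ∖ T) + cutSize H (T ∖ S) + 2 ≤ cutSize H S + cutSize H T
cut-posimodular H S T {a} {i} {b} E Sa Ta Sb Tb = begin
  cutSize H (S ∖ T) + cutSize H (T ∖ S) + 2                    ≡⟨ cong (_+ 2) (cut-+ H (S ∖ T) (T ∖ S)) ⟩
  sumFin (λ j → crosses (S ∖ T) (H j) + crosses (T ∖ S) (H j)) + 2
                                                               ≤⟨ sumFin-mono-gaps (crosses-posimodular ∘ H) ([] ∷ []) (gap ∷ []) ⟩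
  sumFin (λ j → crosses S (H j) + crosses T (H j))             ≡⟨ cut-+ H S T ⟨
  cutSize H S + cutSize H T                                   ∎
  where
  open ≤-Reasoning
  crosses-posimodular : ∀ w → crosses (S ∖ T) w + crosses (T ∖ S) w ≤ crosses S w + crosses T w
  crosses-posimodular nothing        = z≤n
  crosses-posimodular (just (p , q)) = differ-posimodular (S p) (S q) (T p) (T q)
  gap : crosses (S ∖ T) (H i) + crosses (T ∖ S) (H i) + 2 ≤ crosses S (H i) + crosses T (H i)
  gap = subst₂ (λ l r → l + 2 ≤ r)
          (sym (cong₂ _+_ (crosses-EdgeTo H E (S ∖ T)) (crosses-EdgeTo H E (T ∖ S))))
          (sym (cong₂ _+_ (crosses-EdgeTo H E S) (crosses-EdgeTo H E T)))
          gap-at-ends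
    where
    gap-at-ends : differ ((S ∖ T) a) ((S ∖ T) b) + differ ((T ∖ S) a) ((T ∖ S) b) + 2
                    ≤ differ (S a) (S b) + differ (T a) (T b)
    gap-at-ends rewrite Sa | Ta | Sb | Tb = ≤-refl

-- Each listed edge, from v into S, crosses S and is counted by degree H v, but does not cross insert v S.
cut-insert : ∀ {n m} (H : MGraph n m) v S {is : List (Fin m)} → S v ≡ false → Unique is →
  All (λ i → ∃ λ y → EdgeTo H v i y × S y ≡ true) is →
  cutSize H (insert v S) + length is * 2 ≤ cutSize H S + degree H v
cut-insert H v S {is} Sv unique edges = begin
  cutSize H (insert v S) + length is * 2             ≤⟨ sumFin-mono-gaps (crosses-insert ∘ H) unique (All.map gap edges) ⟩
  sumFin (λ i → crosses S (H i) + ends v (H i))      ≡⟨ sumFin-+ (λ i → crosses S (H i)) (λ i → ends v (H i)) ⟩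
  cutSize H S + degree H v                          ∎
  where
  open ≤-Reasoning
  crosses-insert : ∀ w → crosses (insert v S) w ≤ crosses S w + ends v w
  crosses-insert nothing        = z≤n
  crosses-insert (just (a , b)) = differ-insert (S a) (S b) (does (a ≟ v)) (does (b ≟ v))
  gap : ∀ {i} → (∃ λ y → EdgeTo H v i y × S y ≡ true) →
        crosses (insert v S) (H i) + 2 ≤ crosses S (H i) + ends v (H i)
  gap {i} (y , E , Sy) = subst₂ (λ l r → l + 2 ≤ r)
          (sym (crosses-EdgeTo H E (insert v S)))
          (sym (cong₂ _+_ (crosses-EdgeTo H E S) (ends-EdgeTo H y≢v E)))
          gap-at-ends
    where
    y≢v : y ≢ v
    y≢v refl = contradiction (trans (sym Sy) Sv) λ ()
    gap-at-ends : differ (insert v S v) (insert v S y) + 2 ≤ differ (S v) (S y) + 1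
    gap-at-ends rewrite dec-true (v ≟ v) refl | Sv | Sy | ∨-zeroʳ (does (y ≟ v)) = ≤-refl

cut-splitOff : ∀ {n m} (H : MGraph n m) {e f} s t S → e ≢ f →
  cutSize (splitOff H e f s t) S + crosses S (H e) + crosses S (H f) ≡ cutSize H S + crosses S (just (s , t))
cut-splitOff H {e} {f} s t S e≢f = begin
  cutSize H′ S + c e + c f
    ≡⟨ cong₂ (λ x y → cutSize H′ S + x + y) (sumFin-select (const (c e)) e) (sumFin-select (const (c f)) f) ⟨
  cutSize H′ S + sumFin (at e (c e)) + sumFin (at f (c f))
    ≡⟨ cong (_+ sumFin (at f (c f))) (sumFin-+ c′ (at e (c e))) ⟨
  sumFin (λ i → c′ i + at e (c e) i) + sumFin (at f (c f))
    ≡⟨ sumFin-+ (λ i → c′ i + at e (c e) i) (at f (c f)) ⟨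
  sumFin (λ i → c′ i + at e (c e) i + at f (c f) i)
    ≡⟨ sumFin-cong pointwise ⟩
  sumFin (λ i → c i + at e cₛₜ i)
    ≡⟨ sumFin-+ c (at e cₛₜ) ⟩
  cutSize H S + sumFin (at e cₛₜ)
    ≡⟨ cong (cutSize H S +_) (sumFin-select (const cₛₜ) e) ⟩
  cutSize H S + cₛₜ ∎
  where
  open ≡-Reasoning
  H′ : MGraph _ _
  H′ = splitOff H e f s t
  c c′ : Fin _ → ℕ
  c  i = crosses S (H i)
  c′ i = crosses S (H′ i)
  cₛₜ : ℕ
  cₛₜ = crosses S (just (s , t))
  at : Fin _ → ℕ → Fin _ → ℕ
  at a x i = if does (i ≟ a) then x else 0
  pointwise : ∀ i → c′ i + at e (c e) i + at f (c f) i ≡ c i + at e cₛₜ i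
  pointwise i with i ≟ e | i ≟ f
  ... | yes refl | yes refl = contradiction refl e≢f
  ... | yes refl | no _     = trans (+-identityʳ _) (+-comm cₛₜ (c e))
  ... | no _     | yes refl = sym (+-identityʳ _)
  ... | no _     | no _     = +-identityʳ _

decrease-bits : ∀ p q {x y} → x < y → x + bit p + bit q ≡ y + differ p q → p ≡ true × q ≡ true × y ≡ x + 2
decrease-bits true  true  {x} {y} x<y eq = refl , refl , sym (trans (sym (+-assoc x 1 1)) (trans eq (+-identityʳ y)))
decrease-bits true  false {x} {y} x<y eq =
  contradiction (+-cancelʳ-≡ 1 x y (trans (sym (+-identityʳ (x + 1))) eq)) (<⇒≢ x<y)
decrease-bits false true  {x} {y} x<y eq =
  contradiction (+-cancelʳ-≡ 1 x y (trans (cong (_+ 1) (sym (+-identityʳ x))) eq)) (<⇒≢ x<y)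
decrease-bits false false {x} {y} x<y eq =
  contradiction (trans (sym (trans (+-identityʳ (x + 0)) (+-identityʳ x))) (trans eq (+-identityʳ y))) (<⇒≢ x<y)

splitOff-decreases-cut : ∀ {n m} (H : MGraph n m) {v e f s t} S → e ≢ f → EdgeTo H v e s → EdgeTo H v f t →
  S v ≡ false → cutSize (splitOff H e f s t) S < cutSize H S →
  S s ≡ true × S t ≡ true × cutSize H S ≡ cutSize (splitOff H e f s t) S + 2
splitOff-decreases-cut H {v} {e} {f} {s} {t} S e≢f Es Et Sv smaller =
  decrease-bits (S s) (S t) smaller (begin
    cutSize (splitOff H e f s t) S + differ false (S s) + differ false (S t)
      ≡⟨ cong₂ (λ x y → cutSize (splitOff H e f s t) S + x + y)
               (trans (cong (λ b → differ b (S s)) (sym Sv)) (sym (crosses-EdgeTo H Es S)))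
               (trans (cong (λ b → differ b (S t)) (sym Sv)) (sym (crosses-EdgeTo H Et S))) ⟩
    cutSize (splitOff H e f s t) S + crosses S (H e) + crosses S (H f)
      ≡⟨ cut-splitOff H s t S e≢f ⟩
    cutSize H S + differ (S s) (S t) ∎)
  where open ≡-Reasoning

splitOff-preserves-cut : ∀ {n m} (H : MGraph n m) {v e f s t} S → e ≢ f → EdgeTo H v e s → EdgeTo H v f t →
  S v ≡ S s → cutSize (splitOff H e f s t) S ≡ cutSize H S
splitOff-preserves-cut H {v} {e} {f} {s} {t} S e≢f Es Et Sv≡Ss = +-cancelʳ-≡ (differ (S s) (S t)) _ _ (begin
  cutSize (splitOff H e f s t) S + differ (S s) (S t)
    ≡⟨ cong (_+ differ (S s) (S t)) (+-identityʳ _) ⟨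
  cutSize (splitOff H e f s t) S + 0 + differ (S s) (S t)
    ≡⟨ cong₂ (λ x y → cutSize (splitOff H e f s t) S + x + y)
             (sym (trans (crosses-EdgeTo H Es S) (trans (cong (λ b → differ b (S s)) Sv≡Ss) (cong bit (xor-same (S s))))))
             (sym (trans (crosses-EdgeTo H Et S) (cong (λ b → differ b (S t)) Sv≡Ss))) ⟩
  cutSize (splitOff H e f s t) S + crosses S (H e) + crosses S (H f)
    ≡⟨ cut-splitOff H s t S e≢f ⟩
  cutSize H S + differ (S s) (S t) ∎)
  where open ≡-Reasoning

cut-cong-isolated : ∀ {n m} (H : MGraph n m) v {S T : Fin n → Bool} → (∀ i → ends v (H i) ≡ 0) →
  (∀ u → u ≢ v → S u ≡ T u) → cutSize H S ≡ cutSize H T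
cut-cong-isolated H v {S} {T} isolated S≗T = sumFin-cong λ i → crosses-away (H i) (isolated i)
  where
  crosses-away : ∀ w → ends v w ≡ 0 → crosses S w ≡ crosses T w
  crosses-away nothing        _ = refl
  crosses-away (just (a , b)) _  with a ≟ v | b ≟ v
  crosses-away (just (a , b)) () | yes _   | _
  crosses-away (just (a , b)) () | no _    | yes _
  crosses-away (just (a , b)) _  | no a≢v  | no b≢v = cong₂ differ (S≗T a a≢v) (S≗T b b≢v)

does-≟-sym : ∀ {n} (a b : Fin n) → does (a ≟ b) ≡ does (b ≟ a)
does-≟-sym a b with a ≟ b
... | yes a≡b = sym (dec-true (b ≟ a) (sym a≡b))
... | no a≢b  = sym (dec-false (b ≟ a) (a≢b ∘ sym))

spans : ∀ {n} → (Fin n → Bool) → Maybe (Edge n) → ℕ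
spans S nothing        = 0
spans S (just (a , b)) = bit (S a ∧ S b)

endpoints-in : ∀ {n} (S : Fin n → Bool) w → sumFin (λ u → bit (S u) * ends u w) ≡ crosses S w + 2 * spans S w
endpoints-in {n} S nothing = trans (sumFin-cong (λ u → *-zeroʳ (bit (S u)))) (sumFin-zero n)
endpoints-in S (just (a , b)) = begin
  sumFin (λ u → bit (S u) * (bit (does (a ≟ u)) + bit (does (b ≟ u))))
    ≡⟨ sumFin-cong (λ u → trans (cong₂ (λ p q → bit (S u) * (bit p + bit q)) (does-≟-sym a u) (does-≟-sym b u))
                                (bit-*-+ (S u) (does (u ≟ a)) (does (u ≟ b)))) ⟩
  sumFin (λ u → (if does (u ≟ a) then bit (S u) else 0) + (if does (u ≟ b) then bit (S u) else 0))
    ≡⟨ trans (sumFin-+ (λ u → if does (u ≟ a) then bit (S u) else 0)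
                       (λ u → if does (u ≟ b) then bit (S u) else 0))
             (cong₂ _+_ (sumFin-select (bit ∘ S) a) (sumFin-select (bit ∘ S) b)) ⟩
  bit (S a) + bit (S b)
    ≡⟨ bit-+ (S a) (S b) ⟩
  differ (S a) (S b) + 2 * bit (S a ∧ S b) ∎
  where open ≡-Reasoning

handshake : ∀ {n m} (H : MGraph n m) S →
  sumFin (λ u → bit (S u) * degree H u) ≡ cutSize H S + 2 * sumFin (λ i → spans S (H i))
handshake H S = begin
  sumFin (λ u → bit (S u) * degree H u)                    ≡⟨ sumFin-cong (λ u → sumFin-*ˡ (bit (S u)) (λ i → ends u (H i))) ⟩
  sumFin (λ u → sumFin (λ i → bit (S u) * ends u (H i)))   ≡⟨ sumFin-comm (λ u i → bit (S u) * ends u (H i)) ⟩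
  sumFin (λ i → sumFin (λ u → bit (S u) * ends u (H i)))   ≡⟨ sumFin-cong (endpoints-in S ∘ H) ⟩
  sumFin (λ i → crosses S (H i) + 2 * spans S (H i))       ≡⟨ sumFin-+ (crosses S ∘ H) (λ i → 2 * spans S (H i)) ⟩
  cutSize H S + sumFin (λ i → 2 * spans S (H i))           ≡⟨ cong (cutSize H S +_) (sumFin-*ˡ 2 (spans S ∘ H)) ⟨
  cutSize H S + 2 * sumFin (λ i → spans S (H i))           ∎
  where open ≡-Reasoning

cut-even : ∀ {n m} (H : MGraph n m) → (∀ u → 2 ∣ degree H u) → ∀ S → 2 ∣ cutSize H S
cut-even H even S = ∣m+n∣m⇒∣n (subst (2 ∣_) (trans (handshake H S) (+-comm (cutSize H S) _))
                                      (∣-sumFin _ (λ u → ∣n⇒∣m*n (bit (S u)) (even u))))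
                              (m∣m*n (sumFin (spans S ∘ H)))

ends-away : ∀ {n} {v a b : Fin n} → a ≢ v → b ≢ v → ends v (just (a , b)) ≡ 0
ends-away {v = v} {a} {b} a≢v b≢v rewrite dec-false (a ≟ v) a≢v | dec-false (b ≟ v) b≢v = refl

EdgeTo-splitOff : ∀ {n m} (H : MGraph n m) {e f s t v i y} → i ≢ e → i ≢ f →
  EdgeTo H v i y → EdgeTo (splitOff H e f s t) v i y
EdgeTo-splitOff H {e} {f} {i = i} i≢e i≢f = Sum.map (trans unchanged) (trans unchanged)
  where
  unchanged : splitOff H e f _ _ i ≡ H i
  unchanged rewrite dec-false (i ≟ e) i≢e | dec-false (i ≟ f) i≢f = refl

module _ {n m} {H : MGraph n m} where

  EdgeTo-≢ : Loopless H → ∀ {v i y} → EdgeTo H v i y → y ≢ v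
  EdgeTo-≢ loopless (inj₁ Hi≡vy) y≡v = loopless _ _ _ Hi≡vy (sym y≡v)
  EdgeTo-≢ loopless (inj₂ Hi≡yv) y≡v = loopless _ _ _ Hi≡yv y≡v

  EdgeTo-unique : Loopless H → ∀ {v i s t} → EdgeTo H v i s → EdgeTo H v i t → s ≡ t
  EdgeTo-unique loopless (inj₁ p) (inj₁ q) = cong proj₂ (just-injective (trans (sym p) q))
  EdgeTo-unique loopless (inj₂ p) (inj₂ q) = cong proj₁ (just-injective (trans (sym p) q))
  EdgeTo-unique loopless (inj₁ p) (inj₂ q) =
    contradiction (sym (cong proj₂ (just-injective (trans (sym p) q)))) (loopless _ _ _ p)
  EdgeTo-unique loopless (inj₂ p) (inj₁ q) =
    contradiction (cong proj₁ (just-injective (trans (sym p) q))) (loopless _ _ _ p)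

  ends-≤1 : Loopless H → ∀ v i → ends v (H i) ≤ 1
  ends-≤1 loopless v i with H i in Hi≡
  ... | nothing      = z≤n
  ... | just (a , b) with a ≟ v | b ≟ v
  ...   | yes refl | yes refl = contradiction refl (loopless i a a Hi≡)
  ...   | yes _    | no _     = ≤-refl
  ...   | no _     | yes _    = ≤-refl
  ...   | no _     | no _     = z≤n

  EdgeTo⇒ends-pos : ∀ {v i y} → EdgeTo H v i y → 0 < ends v (H i)
  EdgeTo⇒ends-pos {v} (inj₁ Hi≡vy) rewrite Hi≡vy | dec-true (v ≟ v) refl = s≤s z≤n
  EdgeTo⇒ends-pos {v} (inj₂ Hi≡yv) rewrite Hi≡yv | dec-true (v ≟ v) refl = m≤n+m 1 _

  ends-pos⇒Incident : ∀ {v i} → 0 < ends v (H i) → Incident H v i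
  ends-pos⇒Incident {v} {i} pos with H i
  ends-pos⇒Incident {v} ()  | nothing
  ends-pos⇒Incident {v} pos | just (a , b) with a ≟ v | b ≟ v
  ends-pos⇒Incident {v} pos | just (a , b) | yes refl | _        = b , inj₁ refl
  ends-pos⇒Incident {v} pos | just (a , b) | no _     | yes refl = a , inj₂ refl
  ends-pos⇒Incident {v} ()  | just (a , b) | no _     | no _

  other-incident-slots : Loopless H → ∀ {v k e x} → degree H v ≡ suc k → EdgeTo H v e x →
    Σ (Fin k → Fin m) λ ι → Injective _≡_ _≡_ ι × (∀ j → ι j ≢ e × Incident H v (ι j))
  other-incident-slots loopless {v} {k} {e} deg≡ Ee =
    let ι , ι-injective , ι-support = sumFin-support k c′ c′≤1 Σc′≡k
    in ι , ι-injective , λ j → incident-other (ι j) (ι-support j)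
    where
    c c′ : Fin m → ℕ
    c i = ends v (H i)
    c′ = updateAt c e (const 0)
    c′≤1 : ∀ i → c′ i ≤ 1
    c′≤1 i = ≤-trans (updateAt-0-≤ c e i) (ends-≤1 loopless v i)
    Σc′≡k : sumFin c′ ≡ k
    Σc′≡k = suc-injective (trans (sym (sumFin-remove-unit c e (ends-EdgeTo H (EdgeTo-≢ loopless Ee) Ee)))
                                 deg≡)
    incident-other : ∀ i → c′ i ≡ 1 → i ≢ e × Incident H v i
    incident-other i c′i≡1 =
      let i≢e , c′i≡ci = updateAt-0-pos c e i (≤-reflexive (sym c′i≡1))
      in i≢e , ends-pos⇒Incident (subst (0 <_) c′i≡ci (≤-reflexive (sym c′i≡1)))

  incident-slots-exhaust : ∀ {v i} {is : List (Fin m)} → degree H v ≡ length is → Unique is →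
    All (Incident H v) is → All (i ≢_) is → ends v (H i) ≡ 0
  incident-slots-exhaust {v} {i} {is} deg≡ unique incident i∉is = n≤0⇒n≡0 (≮⇒≥ λ 0<ends →
    <-irrefl (sym deg≡) (begin-strict
      length is                                    <⟨ n<1+n (length is) ⟩
      suc (length is)                              ≡⟨ *-identityʳ (suc (length is)) ⟨
      length (i ∷ is) * 1                          ≡⟨ cong (_+ length (i ∷ is) * 1) (sumFin-zero m) ⟨
      sumFin {m} (const 0) + length (i ∷ is) * 1    ≤⟨ sumFin-mono-gaps (λ _ → z≤n) (i∉is ∷ unique)
                                                        (0<ends ∷ All.map (λ (_ , E) → EdgeTo⇒ends-pos E) incident) ⟩
      degree H v                                   ∎))
    where open ≤-Reasoning

SmallCut : ∀ {n m} → ℕ → Fin n → MGraph n m → (Fin n → Bool) → Set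
SmallCut k v H S = (∃ λ a → a ≢ v × S a ≡ true) × (∃ λ b → b ≢ v × S b ≡ false) × cutSize H S < k

smallCut? : ∀ {n m} k v (H : MGraph n m) S → Dec (SmallCut k v H S)
smallCut? k v H S = any? (λ a → ¬? (a ≟ v) ×-dec (S a ≟ᴮ true))
              ×-dec any? (λ b → ¬? (b ≟ v) ×-dec (S b ≟ᴮ false))
              ×-dec (suc (cutSize H S) ≤? k)

connAway-or-smallCut : ∀ {n m} k v (H : MGraph n m) → ConnAway k v H ⊎ ∃ (SmallCut k v H)
connAway-or-smallCut {n} k v H with anySubset? {n = n} (smallCut? k v H ∘ lookup)
... | yes (s , small) = inj₂ (lookup s , small)
... | no ∄small       = inj₁ λ a b a≢v b≢v S Sa Sb → ≮⇒≥ λ below → ∄small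
        (tabulate S , (a , a≢v , trans (lookup∘tabulate S a) Sa) , (b , b≢v , trans (lookup∘tabulate S b) Sb)
                    , subst (_< k) (cut-cong H (sym ∘ lookup∘tabulate S)) below)

record Tight {n m} (G : MGraph n m) (v x y : Fin n) : Set where
  field
    T       : Fin n → Bool
    v∉T     : T v ≡ false
    x∈T     : T x ≡ true
    y∈T     : T y ≡ true
    outside : ∃ λ w → w ≢ v × T w ≡ false
    tight   : cutSize G T ≡ 4

even-between-4-and-5 : ∀ {c} → 2 ∣ c → 4 ≤ c → c ≤ 5 → c ≡ 4
even-between-4-and-5 {c} even 4≤c c≤5 with c ℕ.≟ 5
... | yes refl = contradiction even (from-no (2 ∣? 5))
... | no c≢5   = ≤-antisym (≤-pred (≤∧≢⇒< c≤5 c≢5)) 4≤c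

module _ {n m} (G : MGraph n m) (regular : Regular 4 G) (connected : EdgeConnected 4 G) where

  -- Putting the pair back raises the cut by exactly 2, to at most 5; cuts are even, so it is 4.
  smallCut⇒tight : ∀ {v e f x y} → e ≢ f → EdgeTo G v e x → EdgeTo G v f y →
    ∃ (SmallCut 4 v (splitOff G e f x y)) → Tight G v x y
  smallCut⇒tight {v} {e} {f} {x} {y} e≢f Ex Ey (S , (a , a≢v , Sa) , (b , b≢v , Sb) , small) = record
    { T = T ; v∉T = v∉T ; x∈T = proj₁ decrease ; y∈T = proj₁ (proj₂ decrease) ; outside = proj₂ separated
    ; tight = even-between-4-and-5 (cut-even G (λ u → subst (2 ∣_) (sym (regular u)) (divides 2 refl)) T) large
                (subst (_≤ 5) (sym (proj₂ (proj₂ decrease))) (+-monoˡ-≤ 2 (≤-pred small′))) }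
    where
    G′ : MGraph n m
    G′ = splitOff G e f x y
    T : Fin n → Bool
    T u = S v xor S u
    v∉T : T v ≡ false
    v∉T = xor-same (S v)
    small′ : cutSize G′ T < 4
    small′ = subst (_< 4) (sym (cut-xor G′ (S v) S)) small
    separated : (∃ λ u → T u ≡ true) × (∃ λ w → w ≢ v × T w ≡ false)
    separated with S v
    ... | true  = (b , cong not Sb) , (a , a≢v , cong not Sa)
    ... | false = (a , Sa) , (b , b≢v , Sb)
    large : 4 ≤ cutSize G T
    large = connected T (proj₁ separated) (let w , _ , Tw = proj₂ separated in w , Tw)
    decrease : T x ≡ true × T y ≡ true × cutSize G T ≡ cutSize G′ T + 2
    decrease = splitOff-decreases-cut G T e≢f Ex Ey v∉T (<-≤-trans small′ large)

  -- Two tight sets through x, y₁ and x, y₂ would either leave a common vertex w ≠ v outside (then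
  -- submodularity and adding v to their union give a cut below 4) or each contain a vertex outside
  -- the other (then posimodularity, with the edge vx counted twice, gives one).
  tight-sets-incompatible : ∀ {v e f₁ f₂ x y₁ y₂} → e ≢ f₁ → e ≢ f₂ → f₁ ≢ f₂ →
    EdgeTo G v e x → EdgeTo G v f₁ y₁ → EdgeTo G v f₂ y₂ → Tight G v x y₁ → Tight G v x y₂ → ⊥
  tight-sets-incompatible {v} {e} {f₁} {f₂} {x} {y₁} {y₂} e≢f₁ e≢f₂ f₁≢f₂ Ex Ey₁ Ey₂ D₁ D₂ =
    cases D₁.outside D₂.outside
    where
    module D₁ = Tight D₁
    module D₂ = Tight D₂
    open D₁ using () renaming (T to T₁)
    open D₂ using () renaming (T to T₂)

    8≡ : cutSize G T₁ + cutSize G T₂ ≡ 8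
    8≡ = cong₂ _+_ D₁.tight D₂.tight

    10≰8 : ¬ (10 ≤ 8)
    10≰8 = from-no (10 ≤? 8)

    outside-both : ∀ w → w ≢ v → T₁ w ≡ false → T₂ w ≡ false → ⊥
    outside-both w w≢v w∉T₁ w∉T₂ = 10≰8 (begin
      4 + 6                                   ≤⟨ +-monoˡ-≤ 6 (connected (insert v U) (v , v∈) (w , w∉)) ⟩
      cutSize G (insert v U) + 6              ≤⟨ subst (cutSize G (insert v U) + 6 ≤_) (cong (cutSize G U +_) (regular v))
                                                   (cut-insert G v U (cong₂ _∨_ D₁.v∉T D₂.v∉T) unique edges) ⟩
      cutSize G U + 4                         ≤⟨ +-monoʳ-≤ (cutSize G U) (connected (T₁ ∩ T₂) (x , x∈) (v , v∉)) ⟩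
      cutSize G U + cutSize G (T₁ ∩ T₂)       ≡⟨ +-comm (cutSize G U) _ ⟩
      cutSize G (T₁ ∩ T₂) + cutSize G U       ≤⟨ cut-submodular G T₁ T₂ ⟩
      cutSize G T₁ + cutSize G T₂             ≡⟨ 8≡ ⟩
      8                                       ∎)
      where
      open ≤-Reasoning
      U : Fin n → Bool
      U = T₁ ∪ T₂
      v∈ : insert v U v ≡ true
      v∈ rewrite dec-true (v ≟ v) refl = refl
      x∈ : (T₁ ∩ T₂) x ≡ true
      x∈ = cong₂ _∧_ D₁.x∈T D₂.x∈T
      v∉ : (T₁ ∩ T₂) v ≡ false
      v∉ = cong₂ _∧_ D₁.v∉T D₂.v∉T
      w∉ : insert v U w ≡ false
      w∉ rewrite dec-false (w ≟ v) w≢v | w∉T₁ | w∉T₂ = refl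
      unique : Unique (e ∷ f₁ ∷ f₂ ∷ [])
      unique = (e≢f₁ ∷ e≢f₂ ∷ []) ∷ (f₁≢f₂ ∷ []) ∷ [] ∷ []
      edges : All (λ i → ∃ λ y → EdgeTo G v i y × U y ≡ true) (e ∷ f₁ ∷ f₂ ∷ [])
      edges = (x , Ex , cong (_∨ T₂ x) D₁.x∈T) ∷ (y₁ , Ey₁ , cong (_∨ T₂ y₁) D₁.y∈T)
            ∷ (y₂ , Ey₂ , trans (cong (T₁ y₂ ∨_) D₂.y∈T) (∨-zeroʳ (T₁ y₂))) ∷ []

    outside-each : ∀ {w₁ w₂} → T₂ w₁ ≡ true → T₁ w₁ ≡ false → T₁ w₂ ≡ true → T₂ w₂ ≡ false → ⊥
    outside-each {w₁} {w₂} w₁∈T₂ w₁∉T₁ w₂∈T₁ w₂∉T₂ = 10≰8 (begin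
      4 + 4 + 2                                      ≤⟨ +-monoˡ-≤ 2 (+-mono-≤ (difference-large T₁ T₂ w₂∈T₁ w₂∉T₂ D₁.v∉T)
                                                                         (difference-large T₂ T₁ w₁∈T₂ w₁∉T₁ D₂.v∉T)) ⟩
      cutSize G (T₁ ∖ T₂) + cutSize G (T₂ ∖ T₁) + 2  ≤⟨ cut-posimodular G T₁ T₂ Ex D₁.v∉T D₂.v∉T D₁.x∈T D₂.x∈T ⟩
      cutSize G T₁ + cutSize G T₂                    ≡⟨ 8≡ ⟩
      8                                              ∎)
      where
      open ≤-Reasoning
      difference-large : ∀ S T {w} → S w ≡ true → T w ≡ false → S v ≡ false → 4 ≤ cutSize G (S ∖ T)
      difference-large S T {w} Sw Tw Sv =
        connected (S ∖ T) (w , cong₂ (λ p q → p ∧ not q) Sw Tw) (v , cong (_∧ not (T v)) Sv)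

    cases : (∃ λ w → w ≢ v × T₁ w ≡ false) → (∃ λ w → w ≢ v × T₂ w ≡ false) → ⊥
    cases (w₁ , w₁≢v , w₁∉T₁) (w₂ , w₂≢v , w₂∉T₂) with T₂ w₁ in w₁T₂ | T₁ w₂ in w₂T₁
    ... | false | _     = outside-both w₁ w₁≢v w₁∉T₁ w₁T₂
    ... | true  | false = outside-both w₂ w₂≢v w₂T₁ w₂∉T₂
    ... | true  | true  = outside-each w₁T₂ w₁∉T₁ w₂T₁ w₂∉T₂

  partner-or-tight : ∀ {v e f x y} → f ≢ e → EdgeTo G v e x → EdgeTo G v f y →
    InA v G e f ⊎ Tight G v x y
  partner-or-tight {v} {e} {f} {x} {y} f≢e Ex Ey with connAway-or-smallCut 4 v (splitOff G e f x y)
  ... | inj₁ connAway = inj₁ ((y , Ey) , f≢e , (f≢e ∘ sym) , x , y , Ex , Ey , connAway)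
  ... | inj₂ small    = inj₂ (smallCut⇒tight (f≢e ∘ sym) Ex Ey small)

  partners-among-three : ∀ {v e x} → EdgeTo G v e x → (ι : Fin 3 → Fin m) → Injective _≡_ _≡_ ι →
    (∀ j → ι j ≢ e × Incident G v (ι j)) →
    Σ (Fin m) λ f₁ → Σ (Fin m) λ f₂ → f₁ ≢ f₂ × InA v G e f₁ × InA v G e f₂
  partners-among-three {v} {e} {x} Ex ι ι-injective ι-incident = pick (attempt 0F) (attempt 1F) (attempt 2F)
    where
    y : Fin 3 → Fin n
    y j = proj₁ (proj₂ (ι-incident j))
    E : ∀ j → EdgeTo G v (ι j) (y j)
    E j = proj₂ (proj₂ (ι-incident j))
    attempt : ∀ j → InA v G e (ι j) ⊎ Tight G v x (y j)
    attempt j = partner-or-tight (proj₁ (ι-incident j)) Ex (E j)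
    Partners : Set
    Partners = Σ (Fin m) λ f₁ → Σ (Fin m) λ f₂ → f₁ ≢ f₂ × InA v G e f₁ × InA v G e f₂
    partners : ∀ j k → j ≢ k → InA v G e (ι j) → InA v G e (ι k) → Partners
    partners j k j≢k a b = ι j , ι k , j≢k ∘ ι-injective , a , b
    clash : ∀ j k → j ≢ k → Tight G v x (y j) → Tight G v x (y k) → ⊥
    clash j k j≢k = tight-sets-incompatible (proj₁ (ι-incident j) ∘ sym) (proj₁ (ι-incident k) ∘ sym)
                                           (j≢k ∘ ι-injective) Ex (E j) (E k)
    pick : InA v G e (ι 0F) ⊎ Tight G v x (y 0F) → InA v G e (ι 1F) ⊎ Tight G v x (y 1F) →
           InA v G e (ι 2F) ⊎ Tight G v x (y 2F) → Partners
    pick (inj₁ a)  (inj₁ b)  _         = partners 0F 1F (λ ()) a b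
    pick (inj₁ a)  (inj₂ _)  (inj₁ c)  = partners 0F 2F (λ ()) a c
    pick (inj₂ _)  (inj₁ b)  (inj₁ c)  = partners 1F 2F (λ ()) b c
    pick (inj₂ d₀) (inj₂ d₁) _         = ⊥-elim (clash 0F 1F (λ ()) d₀ d₁)
    pick (inj₂ d₀) (inj₁ _)  (inj₂ d₂) = ⊥-elim (clash 0F 2F (λ ()) d₀ d₂)
    pick (inj₁ _)  (inj₂ d₁) (inj₂ d₂) = ⊥-elim (clash 1F 2F (λ ()) d₁ d₂)

remaining-pair-admissible : ∀ {n m} (G : MGraph n m) → Loopless G → Regular 4 G →
  ∀ {v e f g h x y} → EdgeTo G v e x → EdgeTo G v f y → Admissible v G e f →
  g ≢ h → Incident G v g → Incident G v h → g ≢ e → g ≢ f → h ≢ e → h ≢ f →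
  Admissible v (splitOff G e f x y) g h
remaining-pair-admissible G loopless regular {v} {e} {f} {g} {h} {x} {y} Ex Ey
  (e≢f , s , t , Es , Et , connAway) g≢h (s′ , Eg) (t′ , Eh) g≢e g≢f h≢e h≢f =
  g≢h , s′ , t′ , Eg′ , Eh′ , connAway″
  where
  G′ G″ : MGraph _ _
  G′ = splitOff G e f x y
  G″ = splitOff G′ g h s′ t′
  connAway′ : ConnAway 4 v G′
  connAway′ = subst₂ (λ s t → ConnAway 4 v (splitOff G e f s t))
                (EdgeTo-unique loopless Es Ex) (EdgeTo-unique loopless Et Ey) connAway
  Eg′ : EdgeTo G′ v g s′
  Eg′ = EdgeTo-splitOff G g≢e g≢f Eg
  Eh′ : EdgeTo G′ v h t′
  Eh′ = EdgeTo-splitOff G h≢e h≢f Eh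
  unique : Unique (e ∷ f ∷ g ∷ h ∷ [])
  unique = (e≢f ∷ (g≢e ∘ sym) ∷ (h≢e ∘ sym) ∷ []) ∷ ((g≢f ∘ sym) ∷ (h≢f ∘ sym) ∷ []) ∷ (g≢h ∷ []) ∷ [] ∷ []
  isolated : ∀ i → ends v (G″ i) ≡ 0
  isolated i with i ≟ g | i ≟ h | i ≟ e | i ≟ f
  ... | yes _  | _      | _      | _      = ends-away (EdgeTo-≢ loopless Eg) (EdgeTo-≢ loopless Eh)
  ... | no _   | yes _  | _      | _      = refl
  ... | no _   | no _   | yes _  | _      = ends-away (EdgeTo-≢ loopless Ex) (EdgeTo-≢ loopless Ey)
  ... | no _   | no _   | no _   | yes _  = refl
  ... | no i≢g | no i≢h | no i≢e | no i≢f =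
    incident-slots-exhaust (regular v) unique ((x , Ex) ∷ (y , Ey) ∷ (s′ , Eg) ∷ (t′ , Eh) ∷ [])
                                              (i≢e ∷ i≢f ∷ i≢g ∷ i≢h ∷ [])
  connAway″ : ConnAway 4 v G″
  connAway″ a b a≢v b≢v S Sa Sb =
    subst (4 ≤_) (sym cut≡) (connAway′ a b a≢v b≢v T (trans (T-off a≢v) Sa) (trans (T-off b≢v) Sb))
    where
    T : Fin _ → Bool
    T u = if does (u ≟ v) then S s′ else S u
    T-off : ∀ {u} → u ≢ v → T u ≡ S u
    T-off {u} u≢v rewrite dec-false (u ≟ v) u≢v = refl
    Tv≡Ts′ : T v ≡ T s′
    Tv≡Ts′ rewrite dec-true (v ≟ v) refl = sym (T-off (EdgeTo-≢ loopless Eg))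
    cut≡ : cutSize G″ S ≡ cutSize G′ T
    cut≡ = trans (cut-cong-isolated G″ v isolated (λ u u≢v → sym (T-off u≢v)))
                 (splitOff-preserves-cut G′ T g≢h Eg′ Eh′ Tv≡Ts′)

lemma2 : ∀ {n m} (G : MGraph n m) → Loopless G → Regular 4 G → EdgeConnected 4 G →
         (v : Fin n) (e : Fin m) (x : Fin n) → EdgeTo G v e x →
         (Σ (Fin m) λ f₁ → Σ (Fin m) λ f₂ → f₁ ≢ f₂ × InA v G e f₁ × InA v G e f₂)
         × (∀ (f : Fin m) (y : Fin n) → f ≢ e → EdgeTo G v f y → Admissible v G e f →
            ∀ (g h : Fin m) → g ≢ h → Incident G v g → Incident G v h →
            g ≢ e → g ≢ f → h ≢ e → h ≢ f →
            Admissible v (splitOff G e f x y) g h)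
lemma2 G loopless regular connected v e x Ex =
  let ι , ι-injective , ι-incident = other-incident-slots loopless (regular v) Ex
  in partners-among-three G regular connected Ex ι ι-injective ι-incident
   , λ f y _ Ey admissible g h → remaining-pair-admissible G loopless regular Ex Ey admissible
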